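{- Let $n,k,t,s$ be positive integers with $k\geq t+1$ and $n\geq 2k$. Suppose that $\mathcal{F}\subseteq\binom{[n]}{k}$ and $G\in\binom{[n]}{k}$ satisfy $|\{F\in\mathcal{F}: |F\cap G|<t\}|\leq s$. If $H$ is a non-empty subset of $[n]$ with $|H\cap G|<t$, then there exists a subset $R$ of $[n]$ with $H\subsetneq R$ such that $$|\mathcal{F}_H|\leq (k-t+1)^{|R|-|H|}|\mathcal{F}_R|+s.$$
   Context: $[n]=\{1,\dots,n\}$, $\binom{X}{k}$ is the family of $k$-subsets of $X$. For a family $\mathcal{F}$ and a set $H$, $\mathcal{F}_H=\{F\in\mathcal{F}: H\subseteq F\}$. -}

module Defs where

open import Data.Nat using (ℕ; _<?_; _<_)
open import Data.List using (List; length; filter)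
open import Data.List.Relation.Unary.All using (All)
open import Data.List.Relation.Unary.Unique.Propositional using (Unique)
open import Data.Fin.Subset using (Subset; _⊆_; ∣_∣; _∩_)
open import Data.Fin.Subset.Properties using (_⊆?_)
open import Data.Product using (_×_)
open import Relation.Binary.PropositionalEquality using (_≡_)

IsKFamily : (n k : ℕ) → List (Subset n) → Set
IsKFamily n k 𝓕 = Unique 𝓕 × All (λ F → ∣ F ∣ ≡ k) 𝓕

star : {n : ℕ} → List (Subset n) → Subset n → List (Subset n)
star 𝓕 H = filter (λ F → H ⊆? F) 𝓕

smallInt : {n : ℕ} → List (Subset n) → Subset n → ℕ → List (Subset n)
smallInt 𝓕 G t = filter (λ F → ∣ F ∩ G ∣ <? t) 𝓕

{-# OPTIONS --safe #-}
-- Pick Y ⊆ G ∖ H with |Y| = k − t + 1. Since |G ∖ Y| = t − 1, every F with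
-- |F ∩ G| ≥ t meets Y, so each F ∈ 𝓕_H either is one of the at most s members
-- meeting G in fewer than t points or lies in 𝓕_{H ∪ {y}} for some y ∈ Y. Hence
-- |𝓕_H| ≤ Σ_{y ∈ Y} |𝓕_{H ∪ {y}}| + s ≤ (k − t + 1) |𝓕_R| + s, where
-- R = H ∪ {y} for a y ∈ Y maximising |𝓕_{H ∪ {y}}|.
module Submission where

open import Defs
open import Data.Nat using (ℕ; zero; suc; _+_; _*_; _∸_; _^_; _≤_; _<_; z≤n; s≤s; _≤?_; _<?_)
open import Data.Nat.Properties
open import Data.List using (List; []; _∷_; length; filter)
open import Data.List.Properties using (filter-accept)
open import Data.Vec using ([]; _∷_; here; there)
open import Data.Fin using (Fin; zero; suc)
open import Data.Fin.Subset
  using (Subset; inside; outside; _∈_; _∉_; _⊆_; _⊂_; ∣_∣; _∩_; _∪_; ∁; ⁅_⁆; ⊥; Nonempty)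
open import Data.Fin.Subset.Properties
  using (_⊆?_; nonempty?; out⊆; s⊆s; ⊥⊆; ∣⊥∣≡0; p⊆q⇒∣p∣≤∣q∣; ∩-comm; ∪-identityʳ;
         p∩q⊆p; p∩q⊆q; x∈p∩q⁺; x∈p∩q⁻; x∈p∪q⁻; p⊆p∪q; q⊆p∪q; x∈⁅x⁆; x∈⁅y⁆⇒x≡y;
         x∉p⇒x∈∁p; x∈∁p⇒x∉p)
open import Data.Product using (Σ; ∃; _×_; _,_; proj₁; proj₂)
open import Data.Sum using (_⊎_; inj₁; inj₂)
open import Data.Empty using (⊥-elim)
open import Function using (_∘_)
open import Relation.Nullary using (yes; no)
open import Relation.Unary using (Pred; Decidable)
open import Relation.Binary.PropositionalEquality using (_≡_; refl; sym; trans; cong; subst)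

sumOver : ∀ {n} → Subset n → (Fin n → ℕ) → ℕ
sumOver []            f = 0
sumOver (inside ∷ p)  f = f zero + sumOver p (f ∘ suc)
sumOver (outside ∷ p) f = sumOver p (f ∘ suc)

sumOver-mono-≤ : ∀ {n} (p : Subset n) {f g : Fin n → ℕ} →
  (∀ i → f i ≤ g i) → sumOver p f ≤ sumOver p g
sumOver-mono-≤ []            f≤g = z≤n
sumOver-mono-≤ (inside ∷ p)  f≤g = +-mono-≤ (f≤g zero) (sumOver-mono-≤ p (f≤g ∘ suc))
sumOver-mono-≤ (outside ∷ p) f≤g = sumOver-mono-≤ p (f≤g ∘ suc)

sumOver-mono-< : ∀ {n} (p : Subset n) {f g : Fin n → ℕ} →
  (∀ i → f i ≤ g i) → ∀ {x} → x ∈ p → f x < g x → sumOver p f < sumOver p g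
sumOver-mono-< (inside ∷ p)  f≤g here        fx<gx =
  +-mono-<-≤ fx<gx (sumOver-mono-≤ p (f≤g ∘ suc))
sumOver-mono-< (inside ∷ p)  f≤g (there x∈p) fx<gx =
  +-mono-≤-< (f≤g zero) (sumOver-mono-< p (f≤g ∘ suc) x∈p fx<gx)
sumOver-mono-< (outside ∷ p) f≤g (there x∈p) fx<gx =
  sumOver-mono-< p (f≤g ∘ suc) x∈p fx<gx

sumOver-≤-∣p∣* : ∀ {n} (p : Subset n) {f : Fin n → ℕ} {c : ℕ} →
  (∀ {x} → x ∈ p → f x ≤ c) → sumOver p f ≤ ∣ p ∣ * c
sumOver-≤-∣p∣* []            f≤c = z≤n
sumOver-≤-∣p∣* (inside ∷ p)  f≤c = +-mono-≤ (f≤c here) (sumOver-≤-∣p∣* p (f≤c ∘ there))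
sumOver-≤-∣p∣* (outside ∷ p) f≤c = sumOver-≤-∣p∣* p (f≤c ∘ there)

maximum-attained : ∀ {n} (p : Subset n) (f : Fin n → ℕ) → Nonempty p →
  ∃ λ y → y ∈ p × (∀ {x} → x ∈ p → f x ≤ f y)
maximum-attained (outside ∷ p) f (suc y , there y∈p)
  with z , z∈p , max ← maximum-attained p (f ∘ suc) (y , y∈p)
  = suc z , there z∈p , λ { (there x∈p) → max x∈p }
maximum-attained (inside ∷ p) f _ with nonempty? p
... | no p-empty =
  zero , here , λ { here → ≤-refl ; (there x∈p) → ⊥-elim (p-empty (_ , x∈p)) }
... | yes p-nonempty with z , z∈p , max ← maximum-attained p (f ∘ suc) p-nonempty
                     with f zero ≤? f (suc z)
...   | yes f0≤fz =
  suc z , there z∈p , λ { here → f0≤fz ; (there x∈p) → max x∈p }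
...   | no  f0≰fz =
  zero , here , λ { here → ≤-refl ; (there x∈p) → ≤-trans (max x∈p) (<⇒≤ (≰⇒> f0≰fz)) }

length-filter-≤-∷ : ∀ {a ℓ} {A : Set a} {P : Pred A ℓ} (P? : Decidable P) x xs →
  length (filter P? xs) ≤ length (filter P? (x ∷ xs))
length-filter-≤-∷ P? x xs with P? x
... | yes _ = n≤1+n _
... | no  _ = ≤-refl

module _ {a p q r n} {A : Set a} {P : Pred A p} {Q : Pred A q} {R : Fin n → Pred A r}
         (P? : Decidable P) (Q? : Decidable Q) (R? : ∀ y → Decidable (R y)) (Y : Subset n)
         (cover : ∀ {x} → P x → (∃ λ y → y ∈ Y × R y x) ⊎ Q x) where

  private
    open ≤-Reasoning

    ∑R : List A → ℕ
    ∑R xs = sumOver Y (λ y → length (filter (R? y) xs))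

    #Q : List A → ℕ
    #Q xs = length (filter Q? xs)

    ∑R-∷ : ∀ x xs → ∑R xs ≤ ∑R (x ∷ xs)
    ∑R-∷ x xs = sumOver-mono-≤ Y (λ y → length-filter-≤-∷ (R? y) x xs)

  union-bound : ∀ xs →
    length (filter P? xs) ≤ sumOver Y (λ y → length (filter (R? y) xs)) + length (filter Q? xs)
  union-bound []       = z≤n
  union-bound (x ∷ xs) with P? x
  ... | no  _  = ≤-trans (union-bound xs) (+-mono-≤ (∑R-∷ x xs) (length-filter-≤-∷ Q? x xs))
  ... | yes Px with cover Px
  ...   | inj₁ (y , y∈Y , Ryx) = begin-strict
    length (filter P? xs)     ≤⟨ union-bound xs ⟩
    ∑R xs + #Q xs             <⟨ +-monoˡ-< (#Q xs) ∑R-grows ⟩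
    ∑R (x ∷ xs) + #Q xs       ≤⟨ +-monoʳ-≤ (∑R (x ∷ xs)) (length-filter-≤-∷ Q? x xs) ⟩
    ∑R (x ∷ xs) + #Q (x ∷ xs) ∎
    where
    ∑R-grows : ∑R xs < ∑R (x ∷ xs)
    ∑R-grows = sumOver-mono-< Y (λ y → length-filter-≤-∷ (R? y) x xs) y∈Y
                 (≤-reflexive (sym (cong length (filter-accept (R? y) Ryx))))
  ...   | inj₂ Qx = begin-strict
    length (filter P? xs)     ≤⟨ union-bound xs ⟩
    ∑R xs + #Q xs             ≤⟨ +-monoˡ-≤ (#Q xs) (∑R-∷ x xs) ⟩
    ∑R (x ∷ xs) + #Q xs       <⟨ +-monoʳ-< (∑R (x ∷ xs)) (n<1+n (#Q xs)) ⟩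
    ∑R (x ∷ xs) + suc (#Q xs) ≡⟨ cong (∑R (x ∷ xs) +_) (sym (cong length (filter-accept Q? Qx))) ⟩
    ∑R (x ∷ xs) + #Q (x ∷ xs) ∎

m<n+[m∸n+1] : ∀ {m n} → n ≤ m → m < n + (m ∸ n + 1)
m<n+[m∸n+1] {m} {n} n≤m = begin-strict
  m                 <⟨ n<1+n m ⟩
  suc m             ≡⟨ +-comm 1 m ⟩
  m + 1             ≡⟨ cong (_+ 1) (sym (m+[n∸m]≡n n≤m)) ⟩
  n + (m ∸ n) + 1   ≡⟨ +-assoc n (m ∸ n) 1 ⟩
  n + (m ∸ n + 1)   ∎
  where open ≤-Reasoning

∣p∣>0⇒nonempty : ∀ {n} (p : Subset n) → 0 < ∣ p ∣ → Nonempty p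
∣p∣>0⇒nonempty (inside ∷ p)  _ = zero , here
∣p∣>0⇒nonempty (outside ∷ p) ∣p∣>0 with y , y∈p ← ∣p∣>0⇒nonempty p ∣p∣>0 = suc y , there y∈p

∃-⊆-of-size : ∀ {n} m (p : Subset n) → m ≤ ∣ p ∣ → ∃ λ q → q ⊆ p × ∣ q ∣ ≡ m
∃-⊆-of-size {n} zero p _ = ⊥ , ⊥⊆ , ∣⊥∣≡0 n
∃-⊆-of-size (suc m) (inside ∷ p) (s≤s m≤∣p∣)
  with q , q⊆p , ∣q∣≡m ← ∃-⊆-of-size m p m≤∣p∣ = inside ∷ q , s⊆s q⊆p , cong suc ∣q∣≡m
∃-⊆-of-size (suc m) (outside ∷ p) m<∣p∣
  with q , q⊆p , ∣q∣≡m ← ∃-⊆-of-size (suc m) p m<∣p∣ = outside ∷ q , out⊆ q⊆p , ∣q∣≡m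

∣p∩q∣+∣p∩∁q∣≡∣p∣ : ∀ {n} (p q : Subset n) → ∣ p ∩ q ∣ + ∣ p ∩ ∁ q ∣ ≡ ∣ p ∣
∣p∩q∣+∣p∩∁q∣≡∣p∣ []            []            = refl
∣p∩q∣+∣p∩∁q∣≡∣p∣ (inside ∷ p)  (inside ∷ q)  = cong suc (∣p∩q∣+∣p∩∁q∣≡∣p∣ p q)
∣p∩q∣+∣p∩∁q∣≡∣p∣ (inside ∷ p)  (outside ∷ q) = trans (+-suc _ _) (cong suc (∣p∩q∣+∣p∩∁q∣≡∣p∣ p q))
∣p∩q∣+∣p∩∁q∣≡∣p∣ (outside ∷ p) (_ ∷ q)       = ∣p∩q∣+∣p∩∁q∣≡∣p∣ p q

∣p∣+∣q∣≤∣r∣ : ∀ {n} {p q r : Subset n} → p ⊆ r → q ⊆ r → (∀ {x} → x ∈ p → x ∉ q) →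
  ∣ p ∣ + ∣ q ∣ ≤ ∣ r ∣
∣p∣+∣q∣≤∣r∣ {p = p} {q} {r} p⊆r q⊆r disjoint = begin
  ∣ p ∣ + ∣ q ∣           ≡⟨ +-comm ∣ p ∣ ∣ q ∣ ⟩
  ∣ q ∣ + ∣ p ∣           ≤⟨ +-mono-≤ (p⊆q⇒∣p∣≤∣q∣ q⊆r∩q) (p⊆q⇒∣p∣≤∣q∣ p⊆r∩∁q) ⟩
  ∣ r ∩ q ∣ + ∣ r ∩ ∁ q ∣ ≡⟨ ∣p∩q∣+∣p∩∁q∣≡∣p∣ r q ⟩
  ∣ r ∣                   ∎
  where
  open ≤-Reasoning
  q⊆r∩q : q ⊆ r ∩ q
  q⊆r∩q x∈q = x∈p∩q⁺ (q⊆r x∈q , x∈q)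
  p⊆r∩∁q : p ⊆ r ∩ ∁ q
  p⊆r∩∁q x∈p = x∈p∩q⁺ (p⊆r x∈p , x∉p⇒x∈∁p (disjoint x∈p))

∣p∣∸t+1≤∣p∩∁q∣ : ∀ {n t} (p q : Subset n) → t ≤ ∣ p ∣ → ∣ p ∩ q ∣ < t →
  ∣ p ∣ ∸ t + 1 ≤ ∣ p ∩ ∁ q ∣
∣p∣∸t+1≤∣p∩∁q∣ {t = t} p q t≤∣p∣ ∣p∩q∣<t = begin
  ∣ p ∣ ∸ t + 1                       ≡⟨ +-comm (∣ p ∣ ∸ t) 1 ⟩
  suc (∣ p ∣ ∸ t)                     ≤⟨ ∸-monoʳ-< ∣p∩q∣<t t≤∣p∣ ⟩
  ∣ p ∣ ∸ ∣ p ∩ q ∣                   ≡⟨ cong (_∸ ∣ p ∩ q ∣) (sym (∣p∩q∣+∣p∩∁q∣≡∣p∣ p q)) ⟩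
  ∣ p ∩ q ∣ + ∣ p ∩ ∁ q ∣ ∸ ∣ p ∩ q ∣ ≡⟨ m+n∸m≡n ∣ p ∩ q ∣ ∣ p ∩ ∁ q ∣ ⟩
  ∣ p ∩ ∁ q ∣                         ∎
  where open ≤-Reasoning

x∉p⇒∣p∪⁅x⁆∣≡1+∣p∣ : ∀ {n} (p : Subset n) {x} → x ∉ p → ∣ p ∪ ⁅ x ⁆ ∣ ≡ 1 + ∣ p ∣
x∉p⇒∣p∪⁅x⁆∣≡1+∣p∣ (inside ∷ p)  {zero}  x∉p = ⊥-elim (x∉p here)
x∉p⇒∣p∪⁅x⁆∣≡1+∣p∣ (outside ∷ p) {zero}  _   = cong (suc ∘ ∣_∣) (∪-identityʳ p)
x∉p⇒∣p∪⁅x⁆∣≡1+∣p∣ (inside ∷ p)  {suc x} x∉p = cong suc (x∉p⇒∣p∪⁅x⁆∣≡1+∣p∣ p (x∉p ∘ there))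
x∉p⇒∣p∪⁅x⁆∣≡1+∣p∣ (outside ∷ p) {suc x} x∉p = x∉p⇒∣p∪⁅x⁆∣≡1+∣p∣ p (x∉p ∘ there)

x∉p⇒p⊂p∪⁅x⁆ : ∀ {n} {p : Subset n} {x} → x ∉ p → p ⊂ p ∪ ⁅ x ⁆
x∉p⇒p⊂p∪⁅x⁆ {p = p} {x} x∉p = p⊆p∪q ⁅ x ⁆ , x , q⊆p∪q p ⁅ x ⁆ (x∈⁅x⁆ x) , x∉p

p⊆q∧x∈q⇒p∪⁅x⁆⊆q : ∀ {n} {p q : Subset n} {x} → p ⊆ q → x ∈ q → p ∪ ⁅ x ⁆ ⊆ q
p⊆q∧x∈q⇒p∪⁅x⁆⊆q {p = p} {q} {x} p⊆q x∈q y∈p∪⁅x⁆ with x∈p∪q⁻ p ⁅ x ⁆ y∈p∪⁅x⁆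
... | inj₁ y∈p    = p⊆q y∈p
... | inj₂ y∈⁅x⁆ = subst (_∈ q) (sym (x∈⁅y⁆⇒x≡y x y∈⁅x⁆)) x∈q

meets-or-∣∩∣< : ∀ {n t} {G Y : Subset n} → Y ⊆ G → ∣ G ∣ < t + ∣ Y ∣ →
  ∀ F → Nonempty (F ∩ Y) ⊎ ∣ F ∩ G ∣ < t
meets-or-∣∩∣< {t = t} {G} {Y} Y⊆G ∣G∣<t+∣Y∣ F with nonempty? (F ∩ Y)
... | yes F∩Y-nonempty = inj₁ F∩Y-nonempty
... | no  F∩Y-empty    = inj₂ (+-cancelʳ-< ∣ Y ∣ ∣ F ∩ G ∣ t (begin-strict
  ∣ F ∩ G ∣ + ∣ Y ∣ ≤⟨ ∣p∣+∣q∣≤∣r∣ (p∩q⊆q F G) Y⊆G disjoint ⟩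
  ∣ G ∣             <⟨ ∣G∣<t+∣Y∣ ⟩
  t + ∣ Y ∣         ∎))
  where
  open ≤-Reasoning
  disjoint : ∀ {x} → x ∈ F ∩ G → x ∉ Y
  disjoint x∈F∩G x∈Y = F∩Y-empty (_ , x∈p∩q⁺ (proj₁ (x∈p∩q⁻ F G x∈F∩G) , x∈Y))

star≤[∣G∣∸t+1]*star∪⁅y⁆+smallInt : ∀ {n t} (𝓕 : List (Subset n)) {G Y : Subset n} (H : Subset n) →
  Y ⊆ G → t ≤ ∣ G ∣ → ∣ Y ∣ ≡ ∣ G ∣ ∸ t + 1 →
  ∃ λ y → y ∈ Y × length (star 𝓕 H) ≤
    (∣ G ∣ ∸ t + 1) * length (star 𝓕 (H ∪ ⁅ y ⁆)) + length (smallInt 𝓕 G t)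
star≤[∣G∣∸t+1]*star∪⁅y⁆+smallInt {n} {t} 𝓕 {G} {Y} H Y⊆G t≤∣G∣ ∣Y∣≡
  with y , y∈Y , f≤fy ← maximum-attained Y (λ z → length (star 𝓕 (H ∪ ⁅ z ⁆)))
                          (∣p∣>0⇒nonempty Y (subst (0 <_) (sym ∣Y∣≡) (m≤n+m 1 (∣ G ∣ ∸ t))))
  = y , y∈Y , (begin
    length (star 𝓕 H)
      ≤⟨ union-bound (H ⊆?_) (λ F → ∣ F ∩ G ∣ <? t) (λ z → H ∪ ⁅ z ⁆ ⊆?_) Y cover 𝓕 ⟩
    sumOver Y f + length (smallInt 𝓕 G t)
      ≤⟨ +-monoˡ-≤ _ (sumOver-≤-∣p∣* Y f≤fy) ⟩
    ∣ Y ∣ * f y + length (smallInt 𝓕 G t)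
      ≡⟨ cong (λ c → c * f y + length (smallInt 𝓕 G t)) ∣Y∣≡ ⟩
    (∣ G ∣ ∸ t + 1) * f y + length (smallInt 𝓕 G t)
      ∎)
  where
  open ≤-Reasoning
  f : Fin n → ℕ
  f z = length (star 𝓕 (H ∪ ⁅ z ⁆))
  cover : ∀ {F} → H ⊆ F → (∃ λ z → z ∈ Y × H ∪ ⁅ z ⁆ ⊆ F) ⊎ ∣ F ∩ G ∣ < t
  cover {F} H⊆F
    with meets-or-∣∩∣< Y⊆G (subst (λ c → ∣ G ∣ < t + c) (sym ∣Y∣≡) (m<n+[m∸n+1] t≤∣G∣)) F
  ... | inj₂ ∣F∩G∣<t     = inj₂ ∣F∩G∣<t
  ... | inj₁ (z , z∈F∩Y) with z∈F , z∈Y ← x∈p∩q⁻ F Y z∈F∩Y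
    = inj₁ (z , z∈Y , p⊆q∧x∈q⇒p∪⁅x⁆⊆q H⊆F z∈F)

lemma2p1 : (n k t s : ℕ) → 0 < n → 0 < k → 0 < t → 0 < s →
    t + 1 ≤ k → 2 * k ≤ n →
    (𝓕 : List (Subset n)) → IsKFamily n k 𝓕 →
    (G : Subset n) → ∣ G ∣ ≡ k →
    length (smallInt 𝓕 G t) ≤ s →
    (H : Subset n) → Nonempty H → ∣ H ∩ G ∣ < t →
    Σ (Subset n) (λ R → H ⊂ R ×
      length (star 𝓕 H) ≤ (k ∸ t + 1) ^ (∣ R ∣ ∸ ∣ H ∣) * length (star 𝓕 R) + s)
lemma2p1 n .(∣ G ∣) t s _ _ _ _ t+1≤∣G∣ _ 𝓕 _ G refl ∣small∣≤s H _ ∣H∩G∣<t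
  with Y , Y⊆G∩∁H , ∣Y∣≡ ← ∃-⊆-of-size (∣ G ∣ ∸ t + 1) (G ∩ ∁ H)
         (∣p∣∸t+1≤∣p∩∁q∣ G H (m+n≤o⇒m≤o t t+1≤∣G∣) (subst (_< t) (cong ∣_∣ (∩-comm H G)) ∣H∩G∣<t))
  with y , y∈Y , 𝓕H-bound ← star≤[∣G∣∸t+1]*star∪⁅y⁆+smallInt 𝓕 H
         (p∩q⊆p G (∁ H) ∘ Y⊆G∩∁H) (m+n≤o⇒m≤o t t+1≤∣G∣) ∣Y∣≡
  = R , x∉p⇒p⊂p∪⁅x⁆ y∉H , (begin
    length (star 𝓕 H)
      ≤⟨ 𝓕H-bound ⟩
    (∣ G ∣ ∸ t + 1) * length (star 𝓕 R) + length (smallInt 𝓕 G t)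
      ≤⟨ +-monoʳ-≤ _ ∣small∣≤s ⟩
    (∣ G ∣ ∸ t + 1) * length (star 𝓕 R) + s
      ≡⟨ cong (λ c → c * length (star 𝓕 R) + s) (sym exponent) ⟩
    (∣ G ∣ ∸ t + 1) ^ (∣ R ∣ ∸ ∣ H ∣) * length (star 𝓕 R) + s
      ∎)
  where
  open ≤-Reasoning
  R : Subset n
  R = H ∪ ⁅ y ⁆
  y∉H : y ∉ H
  y∉H = x∈∁p⇒x∉p (proj₂ (x∈p∩q⁻ G (∁ H) (Y⊆G∩∁H y∈Y)))
  ∣R∣∸∣H∣≡1 : ∣ R ∣ ∸ ∣ H ∣ ≡ 1
  ∣R∣∸∣H∣≡1 = trans (cong (_∸ ∣ H ∣) (x∉p⇒∣p∪⁅x⁆∣≡1+∣p∣ H y∉H)) (m+n∸n≡m 1 ∣ H ∣)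
  exponent : (∣ G ∣ ∸ t + 1) ^ (∣ R ∣ ∸ ∣ H ∣) ≡ ∣ G ∣ ∸ t + 1
  exponent = trans (cong ((∣ G ∣ ∸ t + 1) ^_) ∣R∣∸∣H∣≡1) (^-identityʳ (∣ G ∣ ∸ t + 1))
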